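{- Let $\alpha,\beta,\delta\in\mathbb{Z}$ with $\delta\ge\alpha>0$, let $f:\mathbb{Z}\to\mathbb{Z}$ be $f(r)=(\alpha\cdot r+\beta)/\delta$, let $\mathring{f}(r)=(\alpha\cdot r+\beta)\%\delta$, and let $\hat f:\mathbb{Z}\to\mathbb{Z}$ be $\hat f(q)=(\delta\cdot q+\alpha-\beta-1)/\alpha$. Then for all $r,q\in\mathbb{Z}$: (1) $f(\hat f(q))=q$ and $f(\hat f(q)-1)=q-1$; (2) $f(r)=q$ if and only if $r\in[\hat f(q),\hat f(q+1)[$; (3) $r\in[\hat f(f(r)),\hat f(f(r)+1)[$ and $\mathring{f}(r)/\alpha = r-\hat f(f(r))$.
   Context: For $n,\delta\in\mathbb{Z}$ with $\delta\neq0$, $n/\delta$ and $n\%\delta$ denote the quotient and remainder of Euclidean division: the unique integers $q,s$ with $n=q\cdot\delta+s$ and $0\le s<|\delta|$. The operators $\cdot$, $/$, $\%$ have equal precedence and associate left to right. For integers $a,b$, $[a,b[$ denotes $\{r\in\mathbb{Z}: a\le r<b\}$. -}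

module Defs where

open import Data.Integer using (ℤ; +_; _+_; _-_; _*_; _≤_; _<_; _>_; 0ℤ; 1ℤ; NonZero; >-nonZero)
open import Data.Integer.DivMod using (_/_; _%_)
open import Data.Product using (_×_)

_∈[_,_[ : ℤ → ℤ → ℤ → Set
r ∈[ a , b [ = (a ≤ r) × (r < b)

-- The stdlib's ℤ-division
-- Data.Integer.DivMod._/_ and _%_ are Euclidean:
--   n ≡ + (n % d) + (n / d) * d  with  0 ≤ n % d < ∣ d ∣ ,
-- the remainder being returned as a natural number (we embed it with +_).
div : ℤ → (d : ℤ) → d > 0ℤ → ℤ
div n d d>0 = _/_ n d {{>-nonZero d>0}}

mod : ℤ → (d : ℤ) → d > 0ℤ → ℤ
mod n d d>0 = + (_%_ n d {{>-nonZero d>0}})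

f : (α β δ : ℤ) → δ > 0ℤ → ℤ → ℤ
f α β δ δ>0 r = div (α * r + β) δ δ>0

f̊ : (α β δ : ℤ) → δ > 0ℤ → ℤ → ℤ
f̊ α β δ δ>0 r = mod (α * r + β) δ δ>0

f̂ : (α β δ : ℤ) → α > 0ℤ → ℤ → ℤ
f̂ α β δ α>0 q = div (δ * q + α - β - 1ℤ) α α>0

-- Since δ > 0, f r ≥ q means α·r + β ≥ δ·q, i.e. r ≥ ⌈(δ·q − β)/α⌉ = f̂ q: the maps f̂ and f form a
-- Galois connection  f̂ q ≤ r ⇔ q ≤ f r.  Part (2) is a reformulation of it, part (3) is (2) at q = f r
-- together with a computation of f̂ (f r) from the Euclidean decomposition α·r + β = f̊ r + (f r)·δ,
-- and part (1) follows from (2) once f̂ is strictly increasing, which is where α ≤ δ is needed.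
module Submission where

open import Defs
open import Data.Integer using (ℤ; _+_; _-_; _≤_; _>_; 0ℤ; 1ℤ)
open import Data.Integer.Properties using (<-≤-trans)
open import Data.Product using (_×_)
open import Relation.Binary.PropositionalEquality using (_≡_)
open import Function.Bundles using (_⇔_)

open import Data.Integer using (+_; _*_; _<_; +<+; -1ℤ; >-nonZero)
open import Data.Integer.Properties
  using (≤-refl; ≤-trans; ≤-antisym; ≤-reflexive; ≤⇒≯; <⇒≱; ≮⇒≥; ≰⇒>;
         i<j⇒suc[i]≤j; suc[i]≤j⇒i<j; i<j⇒i≤pred[j]; i≤pred[j]⇒i<j; i≤j⇒0≤j-i; 0≤i-j⇒j≤i;
         +-comm; +-mono-≤; +-monoˡ-<; suc-*; *-monoʳ-≤-nonNeg; module ≤-Reasoning)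
open import Data.Integer.DivMod using (_%_; a≡a%n+[a/n]*n; n%d<d; [n/d]*d≤n)
open import Data.Integer.Tactic.RingSolver using (solve)
open import Data.List using (_∷_; [])
open import Data.Product using (_,_)
open import Function.Bundles using (mk⇔; Equivalence)
open import Relation.Binary.PropositionalEquality using (refl; sym; cong; subst; module ≡-Reasoning)
open import Relation.Nullary using (¬_)

open Equivalence using (to; from)

≤-by-difference : ∀ {i j k l} → i ≤ j → j - i ≡ l - k → k ≤ l
≤-by-difference i≤j eq = 0≤i-j⇒j≤i (subst (0ℤ ≤_) eq (i≤j⇒0≤j-i i≤j))

≤⇔≮ : ∀ {i j} → (i ≤ j) ⇔ (¬ j < i)
≤⇔≮ = mk⇔ ≤⇒≯ ≮⇒≥

<⇔+1≤ : ∀ {i j} → (i < j) ⇔ (i + 1ℤ ≤ j)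
<⇔+1≤ {i} = mk⇔ (λ i<j → subst (_≤ _) (+-comm 1ℤ i) (i<j⇒suc[i]≤j i<j))
                (λ i+1≤j → suc[i]≤j⇒i<j (subst (_≤ _) (+-comm i 1ℤ) i+1≤j))

<⇔≤-1 : ∀ {i j} → (i < j) ⇔ (i ≤ j - 1ℤ)
<⇔≤-1 {i} {j} = mk⇔
  (λ i<j → subst (i ≤_) (+-comm -1ℤ j) (i<j⇒i≤pred[j] i<j))
  (λ i≤j-1 → i≤pred[j]⇒i<j (subst (i ≤_) (+-comm j -1ℤ) i≤j-1))

div*≤ : ∀ n {d} (d>0 : d > 0ℤ) → div n d d>0 * d ≤ n
div*≤ n {d} d>0 = [n/d]*d≤n n d {{>-nonZero d>0}}

<[1+div]* : ∀ n {d} (d>0 : d > 0ℤ) → n < (1ℤ + div n d d>0) * d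
<[1+div]* n {d@(+ _)} d>0@(+<+ _) = begin-strict
  n                  ≡⟨ a≡a%n+[a/n]*n n d ⟩
  + (n % d) + q * d  <⟨ +-monoˡ-< (q * d) (+<+ (n%d<d n d)) ⟩
  d + q * d          ≡⟨ sym (suc-* q d) ⟩
  (1ℤ + q) * d       ∎
  where
  open ≤-Reasoning
  instance _ = >-nonZero d>0
  q = div n d d>0

≤div⇔*≤ : ∀ n {x d} (d>0 : d > 0ℤ) → (x ≤ div n d d>0) ⇔ (x * d ≤ n)
≤div⇔*≤ n {x} {d@(+ _)} d>0@(+<+ _) = mk⇔
  (λ x≤q → ≤-trans (*-monoʳ-≤-nonNeg d x≤q) (div*≤ n d>0))
  (λ x*d≤n → from ≤⇔≮ λ q<x →
    <⇒≱ (<[1+div]* n d>0) (≤-trans (*-monoʳ-≤-nonNeg d (i<j⇒suc[i]≤j q<x)) x*d≤n))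

div-unique : ∀ n {x d} (d>0 : d > 0ℤ) → x * d ≤ n → n < (1ℤ + x) * d → div n d d>0 ≡ x
div-unique n d>0 x*d≤n n<[1+x]*d = ≤-antisym
  (from ≤⇔≮ λ x<q → <⇒≱ n<[1+x]*d (to (≤div⇔*≤ n d>0) (i<j⇒suc[i]≤j x<q)))
  (from (≤div⇔*≤ n d>0) x*d≤n)

module AffineDivision (α β δ : ℤ) (α>0 : α > 0ℤ) (δ>0 : δ > 0ℤ) where

  private
    F F̂ F̊ : ℤ → ℤ
    F = f α β δ δ>0
    F̂ = f̂ α β δ α>0
    F̊ = f̊ α β δ δ>0

  <f̂⇔<*δ : ∀ {r q} → (r < F̂ q) ⇔ (α * r + β < q * δ)
  <f̂⇔<*δ {r} {q} = mk⇔
    (λ r<f̂q → suc[i]≤j⇒i<j (≤-by-difference (to numerator (i<j⇒suc[i]≤j r<f̂q)) slack))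
    (λ lt → suc[i]≤j⇒i<j (from numerator (≤-by-difference (i<j⇒suc[i]≤j lt) (sym slack))))
    where
    numerator : (1ℤ + r ≤ F̂ q) ⇔ ((1ℤ + r) * α ≤ δ * q + α - β - 1ℤ)
    numerator = ≤div⇔*≤ (δ * q + α - β - 1ℤ) α>0
    slack : (δ * q + α - β - 1ℤ) - (1ℤ + r) * α ≡ q * δ - (1ℤ + (α * r + β))
    slack = solve (α ∷ β ∷ δ ∷ r ∷ q ∷ [])

  f̂≤⇔≤f : ∀ {r q} → (F̂ q ≤ r) ⇔ (q ≤ F r)
  f̂≤⇔≤f {r} = mk⇔
    (λ f̂q≤r → from (≤div⇔*≤ (α * r + β) δ>0) (from ≤⇔≮ λ lt → to ≤⇔≮ f̂q≤r (from <f̂⇔<*δ lt)))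
    (λ q≤fr → from ≤⇔≮ λ r<f̂q → to ≤⇔≮ (to (≤div⇔*≤ (α * r + β) δ>0) q≤fr) (to <f̂⇔<*δ r<f̂q))

  f≡⇔∈ : ∀ {r q} → (F r ≡ q) ⇔ (r ∈[ F̂ q , F̂ (q + 1ℤ) [)
  f≡⇔∈ {r} {q} = mk⇔
    (λ fr≡q → from f̂≤⇔≤f (≤-reflexive (sym fr≡q))
            , ≰⇒> λ f̂[q+1]≤r → to ≤⇔≮ (≤-reflexive fr≡q) (from <⇔+1≤ (to f̂≤⇔≤f f̂[q+1]≤r)))
    (λ (f̂q≤r , r<f̂[q+1]) → ≤-antisym
      (from ≤⇔≮ λ q<fr → to ≤⇔≮ (from f̂≤⇔≤f (to <⇔+1≤ q<fr)) r<f̂[q+1])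
      (to f̂≤⇔≤f f̂q≤r))

  r-f̂-unique : ∀ {r q m t} → α * r + β ≡ m + q * δ → t * α ≤ m → m < (1ℤ + t) * α → t ≡ r - F̂ q
  r-f̂-unique {r} {q} {m} {t} euclid t*α≤m m<[1+t]*α = begin
    t            ≡⟨ solve (r ∷ t ∷ []) ⟩
    r - (r - t)  ≡⟨ cong (r -_) (sym f̂q≡r-t) ⟩
    r - F̂ q      ∎
    where
    open ≡-Reasoning
    numerator≡ : δ * q + α - β - 1ℤ ≡ α * r + α - 1ℤ - m
    numerator≡ = begin
      δ * q + α - β - 1ℤ                    ≡⟨ solve (α ∷ β ∷ δ ∷ r ∷ q ∷ []) ⟩
      α * r + α - 1ℤ - (α * r + β - q * δ)  ≡⟨ cong (λ n → α * r + α - 1ℤ - (n - q * δ)) euclid ⟩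
      α * r + α - 1ℤ - (m + q * δ - q * δ)  ≡⟨ solve (α ∷ δ ∷ r ∷ q ∷ m ∷ []) ⟩
      α * r + α - 1ℤ - m                    ∎
    lower-slack : (1ℤ + t) * α - (1ℤ + m) ≡ (α * r + α - 1ℤ - m) - (r - t) * α
    lower-slack = solve (α ∷ r ∷ t ∷ m ∷ [])
    upper-slack : m - t * α ≡ (1ℤ + (r - t)) * α - (1ℤ + (α * r + α - 1ℤ - m))
    upper-slack = solve (α ∷ r ∷ t ∷ m ∷ [])
    f̂q≡r-t : F̂ q ≡ r - t
    f̂q≡r-t = subst (λ n → div n α α>0 ≡ r - t) (sym numerator≡)
      (div-unique (α * r + α - 1ℤ - m) α>0
        (≤-by-difference (i<j⇒suc[i]≤j m<[1+t]*α) lower-slack)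
        (suc[i]≤j⇒i<j (≤-by-difference t*α≤m upper-slack)))

  f̊/α≡r-f̂[fr] : ∀ r → div (F̊ r) α α>0 ≡ r - F̂ (F r)
  f̊/α≡r-f̂[fr] r = r-f̂-unique (a≡a%n+[a/n]*n (α * r + β) δ {{>-nonZero δ>0}})
    (div*≤ (F̊ r) α>0) (<[1+div]* (F̊ r) α>0)

  module _ (α≤δ : α ≤ δ) where

    f̂-strictMono : ∀ q → F̂ q < F̂ (q + 1ℤ)
    f̂-strictMono q = from <⇔+1≤ (from (≤div⇔*≤ (δ * (q + 1ℤ) + α - β - 1ℤ) α>0) (begin
      (F̂ q + 1ℤ) * α              ≡⟨ cong (_* α) (+-comm (F̂ q) 1ℤ) ⟩
      (1ℤ + F̂ q) * α              ≡⟨ suc-* (F̂ q) α ⟩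
      α + F̂ q * α                 ≤⟨ +-mono-≤ α≤δ (div*≤ (δ * q + α - β - 1ℤ) α>0) ⟩
      δ + (δ * q + α - β - 1ℤ)    ≡⟨ solve (α ∷ β ∷ δ ∷ q ∷ []) ⟩
      δ * (q + 1ℤ) + α - β - 1ℤ   ∎))
      where open ≤-Reasoning

    f[f̂q]≡q : ∀ q → F (F̂ q) ≡ q
    f[f̂q]≡q q = from f≡⇔∈ (≤-refl , f̂-strictMono q)

    f[f̂q-1]≡q-1 : ∀ q → F (F̂ q - 1ℤ) ≡ q - 1ℤ
    f[f̂q-1]≡q-1 q = from f≡⇔∈
      ( to <⇔≤-1 (subst (λ p → F̂ (q - 1ℤ) < F̂ p) q-1+1≡q (f̂-strictMono (q - 1ℤ)))
      , subst (λ p → F̂ q - 1ℤ < F̂ p) (sym q-1+1≡q) (from <⇔≤-1 ≤-refl))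
      where
      q-1+1≡q : q - 1ℤ + 1ℤ ≡ q
      q-1+1≡q = solve (q ∷ [])

theorem1 : (α β δ : ℤ) (α>0 : α > 0ℤ) (α≤δ : α ≤ δ) →
    let δ>0 = <-≤-trans α>0 α≤δ in
    (r q : ℤ) →
      (f α β δ δ>0 (f̂ α β δ α>0 q) ≡ q
        × f α β δ δ>0 (f̂ α β δ α>0 q - 1ℤ) ≡ q - 1ℤ)
      × ((f α β δ δ>0 r ≡ q) ⇔ (r ∈[ f̂ α β δ α>0 q , f̂ α β δ α>0 (q + 1ℤ) [))
      × (r ∈[ f̂ α β δ α>0 (f α β δ δ>0 r) , f̂ α β δ α>0 (f α β δ δ>0 r + 1ℤ) [
        × div (f̊ α β δ δ>0 r) α α>0 ≡ r - f̂ α β δ α>0 (f α β δ δ>0 r))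
theorem1 α β δ α>0 α≤δ r q =
  (f[f̂q]≡q α≤δ q , f[f̂q-1]≡q-1 α≤δ q) , f≡⇔∈ , (to f≡⇔∈ refl , f̊/α≡r-f̂[fr] r)
  where open AffineDivision α β δ α>0 (<-≤-trans α>0 α≤δ)
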